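{- Let $d\geqslant 2$ be an integer, let $r\leqslant d-2$ be an integer with $\gcd(r,d)=1$, and let $n$ be a positive integer with $n\equiv -r\pmod d$ and $n\geqslant d-r$. Let $a,q$ be indeterminates. If $d$ is odd, then modulo $(1-aq^n)(a-q^n)$, \[ \sum_{k=0}^{n-1}\frac{(q^r;q^d)_k\, q^{dk}\prod_{j=1}^{(d-1)/2}(a^{2j}q^r;q^d)_k\,(a^{ -2j}q^r;q^d)_k}{(q^d;q^d)_k\prod_{j=1}^{(d-1)/2}(a^{2j-1}q^d;q^d)_k\,(a^{1-2j}q^d;q^d)_k}\equiv 0 . \] If $d$ is even, then modulo $(1-aq^n)(a-q^n)$, \[ \sum_{k=0}^{n-1}\frac{q^{dk}\prod_{j=1}^{d/2}(a^{2j-1}q^r;q^d)_k\,(a^{1-2j}q^r;q^d)_k}{\prod_{j=0}^{d/2-1}(a^{2j}q^d;q^d)_k\,(a^{ -2j}q^d;q^d)_k}\equiv 0 . \]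
   Context: $(x;q)_k=(1-x)(1-xq)\cdots(1-xq^{k-1})$ (with $(x;q)_0=1$) is the $q$-shifted factorial. The sums are rational functions in $a$ and $q$ whose denominators are coprime to $(1-aq^n)(a-q^n)$; the congruence to $0$ modulo $(1-aq^n)(a-q^n)$ means that the numerator is divisible by $(1-aq^n)(a-q^n)$ in the ring of Laurent polynomials in $a,q$ with rational coefficients (equivalently, the sum vanishes at $a=q^{n}$ and at $a=q^{ -n}$). -}

module Defs where

open import Data.Nat as ℕ using (ℕ; zero; suc)
open import Data.Integer as ℤ using (ℤ; +_; -[1+_])
open import Data.Rational using (ℚ; 0ℚ; 1ℚ; _+_; _*_; _-_; 1/_; ≢-nonZero)
open import Data.Rational.Properties using (_≟_)
open import Relation.Nullary using (yes; no)

-- total inverse on ℚ (inv 0 = 0); only ever applied to nonzero values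
-- under the hypotheses of the theorem
inv : ℚ → ℚ
inv p with p ≟ 0ℚ
... | yes _ = 0ℚ
... | no p≢0 = 1/_ p {{≢-nonZero p≢0}}

powN : ℚ → ℕ → ℚ
powN x zero = 1ℚ
powN x (suc n) = x * powN x n

powZ : ℚ → ℤ → ℚ
powZ x (+ n) = powN x n
powZ x -[1+ n ] = inv (powN x (suc n))

sumR : ℕ → (ℕ → ℚ) → ℚ
sumR zero f = 0ℚ
sumR (suc n) f = sumR n f + f n

prodR : ℕ → (ℕ → ℚ) → ℚ
prodR zero f = 1ℚ
prodR (suc n) f = prodR n f * f n

qpoch : ℚ → ℚ → ℕ → ℚ
qpoch x p k = prodR k (λ i → 1ℚ - x * powN p i)

2j : ℕ → ℤ
2j j = + (2 ℕ.* j)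

2j-1 : ℕ → ℤ
2j-1 j = 2j j ℤ.- + 1

1-2j : ℕ → ℤ
1-2j j = + 1 ℤ.- 2j j

-- Odd d, m = (d-1)/2 = ⌊d/2⌋.  k-th numerator and denominator.
oddNum : ℕ → ℤ → ℚ → ℚ → ℕ → ℚ
oddNum d r a q k =
  qpoch (powZ q r) (powN q d) k * powN q (d ℕ.* k) *
  prodR (d ℕ./ 2) (λ i → let j = suc i in
    qpoch (powZ a (2j j) * powZ q r) (powN q d) k *
    qpoch (powZ a (ℤ.- 2j j) * powZ q r) (powN q d) k)

oddDen : ℕ → ℤ → ℚ → ℚ → ℕ → ℚ
oddDen d r a q k =
  qpoch (powN q d) (powN q d) k *
  prodR (d ℕ./ 2) (λ i → let j = suc i in
    qpoch (powZ a (2j-1 j) * powN q d) (powN q d) k *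
    qpoch (powZ a (1-2j j) * powN q d) (powN q d) k)

oddSum : ℕ → ℤ → ℕ → ℚ → ℚ → ℚ
oddSum d r n a q = sumR n (λ k → oddNum d r a q k * inv (oddDen d r a q k))

evenNum : ℕ → ℤ → ℚ → ℚ → ℕ → ℚ
evenNum d r a q k =
  powN q (d ℕ.* k) *
  prodR (d ℕ./ 2) (λ i → let j = suc i in
    qpoch (powZ a (2j-1 j) * powZ q r) (powN q d) k *
    qpoch (powZ a (1-2j j) * powZ q r) (powN q d) k)

evenDen : ℕ → ℤ → ℚ → ℚ → ℕ → ℚ
evenDen d r a q k =
  prodR (d ℕ./ 2) (λ j →
    qpoch (powZ a (2j j) * powN q d) (powN q d) k *
    qpoch (powZ a (ℤ.- 2j j) * powN q d) (powN q d) k)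

evenSum : ℕ → ℤ → ℕ → ℚ → ℚ → ℚ
evenSum d r n a q = sumR n (λ k → evenNum d r a q k * inv (evenDen d r a q k))

-- With p = q^d and a = q^n, write n + r = (m + 1) d and N = n − m − 1.  Then a q^r = p^(m+1),
-- so every numerator parameter of the sum is p^m times a denominator parameter, except one, u,
-- which satisfies u p^N = 1.  Both sums therefore have the shape
--
--   Σ_{k<n} (u;p)_k p^k ∏_i (z_i p^m;p)_k / ((p;p)_k ∏_i (z_i;p)_k)
--
-- with d − 1 parameters z_i.  Multiplying by ∏_i (z_i;p)_m and using
-- (z p^m;p)_k (z;p)_m = (z;p)_k (z p^k;p)_m turns the k-th term into c_k p^k R(p^k), where
-- c_k = (u;p)_k / (p;p)_k and R is a polynomial of degree (d − 1) m < N.  The series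
-- M(y) = Σ_k c_k y^k is the terminating q-binomial series (uy;p)_N, which vanishes at
-- y = p, …, p^N; hence Σ_k c_k p^(jk) R(p^k) = 0 whenever 1 ≤ j and j + deg R ≤ N.
-- The case a = q^(−n) follows because both sums are invariant under a ↦ a⁻¹.

{-# OPTIONS --safe #-}
module Submission where

open import Defs
open import Data.Nat as ℕ using (ℕ; zero; suc; _<_; _≤_; _≥_; s≤s; z≤n)
import Data.Nat.Properties as ℕP
open import Data.Integer as ℤ using (ℤ; +_; -[1+_]; _⊖_)
import Data.Integer.Divisibility as ℤD
open import Data.Integer.GCD using (gcd)
import Data.Integer.Properties as ℤP
import Data.Integer.Tactic.RingSolver as ℤ-Solver
import Data.Nat.Tactic.RingSolver as ℕ-Solver
open import Data.Rational using (ℚ; 0ℚ; 1ℚ; _+_; _*_; _-_; -_; ≢-nonZero)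
open import Data.Rational.Properties
  using (_≟_; 1≢0; +-*-commutativeRing; *-inverseʳ; *-identityˡ; *-identityʳ; *-zeroˡ; *-zeroʳ; *-comm; *-assoc;
         +-identityˡ; +-identityʳ; +-assoc)
open import Data.Empty using (⊥-elim)
open import Data.Nat.DivMod using (+-distrib-/-∣ʳ; m*n/n≡m; m≡m%n+[m/n]*n; m%n<n)
open import Data.Nat.Divisibility using (_∣_; divides; divides-refl; m%n≡0⇒n∣m)
open import Data.Sum using (inj₁; inj₂)
open import Data.Product using (∃; ∃₂; _×_; _,_)
open import Level using (0ℓ)
open import Relation.Binary.PropositionalEquality
open import Relation.Nullary using (yes; no; ¬_; Dec)
open import Relation.Nullary.Decidable using (dec⇒maybe)
open import Tactic.RingSolver using (solve-∀)
open import Tactic.RingSolver.Core.AlmostCommutativeRing using (AlmostCommutativeRing; fromCommutativeRing)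
open ≡-Reasoning

ℚ-ring : AlmostCommutativeRing 0ℓ 0ℓ
ℚ-ring = fromCommutativeRing +-*-commutativeRing (λ x → dec⇒maybe (0ℚ ≟ x))

inv-inverseʳ : ∀ {x} → x ≢ 0ℚ → x * inv x ≡ 1ℚ
inv-inverseʳ {x} x≢0 with x ≟ 0ℚ
... | yes x≡0 = ⊥-elim (x≢0 x≡0)
... | no x≢0′ = *-inverseʳ x {{≢-nonZero x≢0′}}

x*y≡0⇒y≡0 : ∀ {x y} → x ≢ 0ℚ → x * y ≡ 0ℚ → y ≡ 0ℚ
x*y≡0⇒y≡0 {x} {y} x≢0 xy≡0 = begin
  y                 ≡⟨ sym (*-identityˡ y) ⟩
  1ℚ * y            ≡⟨ cong (_* y) (sym (inv-inverseʳ x≢0)) ⟩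
  (x * inv x) * y   ≡⟨ rearrange x (inv x) y ⟩
  (x * y) * inv x   ≡⟨ cong (_* inv x) xy≡0 ⟩
  0ℚ * inv x        ≡⟨ *-zeroˡ (inv x) ⟩
  0ℚ                ∎
  where
  rearrange : ∀ x i y → (x * i) * y ≡ (x * y) * i
  rearrange = solve-∀ ℚ-ring

*-≢0 : ∀ {x y} → x ≢ 0ℚ → y ≢ 0ℚ → x * y ≢ 0ℚ
*-≢0 x≢0 y≢0 xy≡0 = y≢0 (x*y≡0⇒y≡0 x≢0 xy≡0)

x*y≢0⇒x≢0 : ∀ {x} y → x * y ≢ 0ℚ → x ≢ 0ℚ
x*y≢0⇒x≢0 y xy≢0 refl = xy≢0 (*-zeroˡ y)

x*y≢0⇒y≢0 : ∀ x {y} → x * y ≢ 0ℚ → y ≢ 0ℚ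
x*y≢0⇒y≢0 x xy≢0 refl = xy≢0 (*-zeroʳ x)

inv-unique : ∀ x {y} → x * y ≡ 1ℚ → inv x ≡ y
inv-unique x {y} xy≡1 = begin
  inv x              ≡⟨ sym (*-identityʳ (inv x)) ⟩
  inv x * 1ℚ         ≡⟨ cong (inv x *_) (sym xy≡1) ⟩
  inv x * (x * y)    ≡⟨ rearrange x (inv x) y ⟩
  (x * inv x) * y    ≡⟨ cong (_* y) (inv-inverseʳ x≢0) ⟩
  1ℚ * y             ≡⟨ *-identityˡ y ⟩
  y                  ∎
  where
  x≢0 : x ≢ 0ℚ
  x≢0 = x*y≢0⇒x≢0 y (λ xy≡0 → 1≢0 (trans (sym xy≡1) xy≡0))
  rearrange : ∀ x i y → i * (x * y) ≡ (x * i) * y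
  rearrange = solve-∀ ℚ-ring

inv-distrib-* : ∀ x y → inv (x * y) ≡ inv x * inv y
inv-distrib-* x y = by-cases (x ≟ 0ℚ) (y ≟ 0ℚ)
  where
  rearrange : ∀ x y i j → (x * y) * (i * j) ≡ (x * i) * (y * j)
  rearrange = solve-∀ ℚ-ring
  by-cases : Dec (x ≡ 0ℚ) → Dec (y ≡ 0ℚ) → inv (x * y) ≡ inv x * inv y
  by-cases (yes refl) _ = trans (cong inv (*-zeroˡ y)) (sym (*-zeroˡ (inv y)))
  by-cases (no _) (yes refl) = trans (cong inv (*-zeroʳ x)) (sym (*-zeroʳ (inv x)))
  by-cases (no x≢0) (no y≢0) = inv-unique (x * y) (begin
    (x * y) * (inv x * inv y)   ≡⟨ rearrange x y (inv x) (inv y) ⟩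
    (x * inv x) * (y * inv y)   ≡⟨ cong₂ _*_ (inv-inverseʳ x≢0) (inv-inverseʳ y≢0) ⟩
    1ℚ                          ∎)

x*inv[z]*z≡x : ∀ x z → (z ≡ 0ℚ → x ≡ 0ℚ) → x * inv z * z ≡ x
x*inv[z]*z≡x x z z≡0⇒x≡0 = by-cases (z ≟ 0ℚ)
  where
  by-cases : Dec (z ≡ 0ℚ) → x * inv z * z ≡ x
  by-cases (yes z≡0) = trans (cong (x * inv z *_) z≡0) (trans (*-zeroʳ (x * inv z)) (sym (z≡0⇒x≡0 z≡0)))
  by-cases (no z≢0) = begin
    x * inv z * z     ≡⟨ *-assoc x (inv z) z ⟩
    x * (inv z * z)   ≡⟨ cong (x *_) (trans (*-comm (inv z) z) (inv-inverseʳ z≢0)) ⟩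
    x * 1ℚ            ≡⟨ *-identityʳ x ⟩
    x                 ∎

sumR-cong : ∀ n {f g : ℕ → ℚ} → (∀ k → k < n → f k ≡ g k) → sumR n f ≡ sumR n g
sumR-cong zero     f≗g = refl
sumR-cong (suc n)  f≗g = cong₂ _+_ (sumR-cong n (λ k k<n → f≗g k (ℕP.m<n⇒m<1+n k<n))) (f≗g n ℕP.≤-refl)

prodR-cong : ∀ n {f g : ℕ → ℚ} → (∀ k → k < n → f k ≡ g k) → prodR n f ≡ prodR n g
prodR-cong zero     f≗g = refl
prodR-cong (suc n)  f≗g = cong₂ _*_ (prodR-cong n (λ k k<n → f≗g k (ℕP.m<n⇒m<1+n k<n))) (f≗g n ℕP.≤-refl)

sumR-distrib-+ : ∀ n (f g : ℕ → ℚ) → sumR n (λ k → f k + g k) ≡ sumR n f + sumR n g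
sumR-distrib-+ zero    f g = refl
sumR-distrib-+ (suc n) f g = trans (cong (_+ (f n + g n)) (sumR-distrib-+ n f g)) (interchange (sumR n f) (sumR n g) (f n) (g n))
  where
  interchange : ∀ a b c d → (a + b) + (c + d) ≡ (a + c) + (b + d)
  interchange = solve-∀ ℚ-ring

sumR-*ˡ : ∀ n c (f : ℕ → ℚ) → sumR n (λ k → c * f k) ≡ c * sumR n f
sumR-*ˡ zero    c f = sym (*-zeroʳ c)
sumR-*ˡ (suc n) c f = trans (cong (_+ c * f n) (sumR-*ˡ n c f)) (distrib c (sumR n f) (f n))
  where
  distrib : ∀ c a b → c * a + c * b ≡ c * (a + b)
  distrib = solve-∀ ℚ-ring

sumR-suc : ∀ n (f : ℕ → ℚ) → sumR (suc n) f ≡ f 0 + sumR n (λ k → f (suc k))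
sumR-suc zero    f = trans (+-identityˡ (f 0)) (sym (+-identityʳ (f 0)))
sumR-suc (suc n) f = trans (cong (_+ f (suc n)) (sumR-suc n f)) (+-assoc (f 0) _ (f (suc n)))

sumR-reindex : ∀ n (f : ℕ → ℚ) → f 0 ≡ 0ℚ → f n ≡ 0ℚ → sumR n f ≡ sumR n (λ k → f (suc k))
sumR-reindex n f f0≡0 fn≡0 = begin
  sumR n f                          ≡⟨ sym (+-identityʳ (sumR n f)) ⟩
  sumR n f + 0ℚ                     ≡⟨ cong (λ t → sumR n f + t) (sym fn≡0) ⟩
  sumR (suc n) f                    ≡⟨ sumR-suc n f ⟩
  f 0 + sumR n (λ k → f (suc k))    ≡⟨ cong (_+ sumR n (λ k → f (suc k))) f0≡0 ⟩
  0ℚ + sumR n (λ k → f (suc k))     ≡⟨ +-identityˡ _ ⟩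
  sumR n (λ k → f (suc k))          ∎

prodR-distrib-* : ∀ n (f g : ℕ → ℚ) → prodR n (λ k → f k * g k) ≡ prodR n f * prodR n g
prodR-distrib-* zero    f g = refl
prodR-distrib-* (suc n) f g = trans (cong (_* (f n * g n)) (prodR-distrib-* n f g)) (interchange (prodR n f) (prodR n g) (f n) (g n))
  where
  interchange : ∀ a b c d → (a * b) * (c * d) ≡ (a * c) * (b * d)
  interchange = solve-∀ ℚ-ring

prodR-suc : ∀ n (f : ℕ → ℚ) → prodR (suc n) f ≡ f 0 * prodR n (λ k → f (suc k))
prodR-suc zero    f = trans (*-identityˡ (f 0)) (sym (*-identityʳ (f 0)))
prodR-suc (suc n) f = trans (cong (_* f (suc n)) (prodR-suc n f)) (*-assoc (f 0) _ (f (suc n)))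

prodR-+ : ∀ m n (f : ℕ → ℚ) → prodR (m ℕ.+ n) f ≡ prodR m f * prodR n (λ k → f (m ℕ.+ k))
prodR-+ m zero    f = trans (cong (λ l → prodR l f) (ℕP.+-identityʳ m)) (sym (*-identityʳ (prodR m f)))
prodR-+ m (suc n) f = begin
  prodR (m ℕ.+ suc n) f                                     ≡⟨ cong (λ l → prodR l f) (ℕP.+-suc m n) ⟩
  prodR (m ℕ.+ n) f * f (m ℕ.+ n)                           ≡⟨ cong (_* f (m ℕ.+ n)) (prodR-+ m n f) ⟩
  prodR m f * prodR n (λ k → f (m ℕ.+ k)) * f (m ℕ.+ n)     ≡⟨ *-assoc (prodR m f) _ _ ⟩
  prodR m f * prodR (suc n) (λ k → f (m ℕ.+ k))             ∎

powN-distribˡ-+-* : ∀ x m n → powN x (m ℕ.+ n) ≡ powN x m * powN x n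
powN-distribˡ-+-* x zero    n = sym (*-identityˡ (powN x n))
powN-distribˡ-+-* x (suc m) n = trans (cong (x *_) (powN-distribˡ-+-* x m n)) (sym (*-assoc x (powN x m) (powN x n)))

powN-distribʳ-* : ∀ x y n → powN (x * y) n ≡ powN x n * powN y n
powN-distribʳ-* x y zero    = refl
powN-distribʳ-* x y (suc n) = trans (cong ((x * y) *_) (powN-distribʳ-* x y n)) (interchange x y (powN x n) (powN y n))
  where
  interchange : ∀ a b c d → (a * b) * (c * d) ≡ (a * c) * (b * d)
  interchange = solve-∀ ℚ-ring

powN-*-assoc : ∀ x m n → powN (powN x m) n ≡ powN x (m ℕ.* n)
powN-*-assoc x m zero    = cong (powN x) (sym (ℕP.*-zeroʳ m))
powN-*-assoc x m (suc n) = begin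
  powN x m * powN (powN x m) n   ≡⟨ cong (powN x m *_) (powN-*-assoc x m n) ⟩
  powN x m * powN x (m ℕ.* n)    ≡⟨ sym (powN-distribˡ-+-* x m (m ℕ.* n)) ⟩
  powN x (m ℕ.+ m ℕ.* n)         ≡⟨ cong (powN x) (sym (ℕP.*-suc m n)) ⟩
  powN x (m ℕ.* suc n)           ∎

powN-≢0 : ∀ {x} n → x ≢ 0ℚ → powN x n ≢ 0ℚ
powN-≢0 zero    x≢0 ()
powN-≢0 (suc n) x≢0 = *-≢0 x≢0 (powN-≢0 n x≢0)

data Difference : ℤ → Set where
  _⊖′_ : ∀ a b → Difference (a ⊖ b)

difference : ∀ x → Difference x
difference (+ a)    = a ⊖′ 0
difference -[1+ b ] = 0 ⊖′ suc b

module _ {q : ℚ} (q≢0 : q ≢ 0ℚ) where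

  powZ-⊖ : ∀ a b → powZ q (a ⊖ b) ≡ powN q a * inv (powN q b)
  powZ-⊖ a       zero    = sym (*-identityʳ (powN q a))
  powZ-⊖ zero    (suc b) = sym (*-identityˡ _)
  powZ-⊖ (suc a) (suc b) = begin
    powZ q (suc a ⊖ suc b)                    ≡⟨ cong (powZ q) (ℤP.[1+m]⊖[1+n]≡m⊖n a b) ⟩
    powZ q (a ⊖ b)                            ≡⟨ powZ-⊖ a b ⟩
    powN q a * inv (powN q b)                 ≡⟨ sym (*-identityˡ _) ⟩
    1ℚ * (powN q a * inv (powN q b))          ≡⟨ cong (_* (powN q a * inv (powN q b))) (sym (inv-inverseʳ q≢0)) ⟩
    (q * inv q) * (powN q a * inv (powN q b)) ≡⟨ interchange q (inv q) (powN q a) (inv (powN q b)) ⟩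
    (q * powN q a) * (inv q * inv (powN q b)) ≡⟨ cong ((q * powN q a) *_) (sym (inv-distrib-* q (powN q b))) ⟩
    (q * powN q a) * inv (q * powN q b)       ∎
    where
    interchange : ∀ a b c d → (a * b) * (c * d) ≡ (a * c) * (b * d)
    interchange = solve-∀ ℚ-ring

  powZ-distribˡ-+-* : ∀ x y → powZ q (x ℤ.+ y) ≡ powZ q x * powZ q y
  powZ-distribˡ-+-* x y with difference x | difference y
  ... | a ⊖′ b | c ⊖′ e = begin
    powZ q ((a ⊖ b) ℤ.+ (c ⊖ e))
      ≡⟨ cong (powZ q) (⊖-+-⊖ a b c e) ⟩
    powZ q ((a ℕ.+ c) ⊖ (b ℕ.+ e))
      ≡⟨ powZ-⊖ (a ℕ.+ c) (b ℕ.+ e) ⟩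
    powN q (a ℕ.+ c) * inv (powN q (b ℕ.+ e))
      ≡⟨ cong₂ (λ u v → u * inv v) (powN-distribˡ-+-* q a c) (powN-distribˡ-+-* q b e) ⟩
    (powN q a * powN q c) * inv (powN q b * powN q e)
      ≡⟨ cong ((powN q a * powN q c) *_) (inv-distrib-* (powN q b) (powN q e)) ⟩
    (powN q a * powN q c) * (inv (powN q b) * inv (powN q e))
      ≡⟨ interchange (powN q a) (powN q c) (inv (powN q b)) (inv (powN q e)) ⟩
    (powN q a * inv (powN q b)) * (powN q c * inv (powN q e))
      ≡⟨ sym (cong₂ _*_ (powZ-⊖ a b) (powZ-⊖ c e)) ⟩
    powZ q (a ⊖ b) * powZ q (c ⊖ e) ∎
    where
    interchange : ∀ a b c d → (a * b) * (c * d) ≡ (a * c) * (b * d)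
    interchange = solve-∀ ℚ-ring
    ⊖-+-⊖ : ∀ a b c e → (a ⊖ b) ℤ.+ (c ⊖ e) ≡ (a ℕ.+ c) ⊖ (b ℕ.+ e)
    ⊖-+-⊖ a b c e = begin
      (a ⊖ b) ℤ.+ (c ⊖ e)
        ≡⟨ sym (cong₂ ℤ._+_ (ℤP.[+m]-[+n]≡m⊖n a b) (ℤP.[+m]-[+n]≡m⊖n c e)) ⟩
      (+ a ℤ.- + b) ℤ.+ (+ c ℤ.- + e)      ≡⟨ rearrange (+ a) (+ b) (+ c) (+ e) ⟩
      (+ a ℤ.+ + c) ℤ.- (+ b ℤ.+ + e)      ≡⟨ ℤP.[+m]-[+n]≡m⊖n (a ℕ.+ c) (b ℕ.+ e) ⟩
      (a ℕ.+ c) ⊖ (b ℕ.+ e)                ∎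
      where
      rearrange : ∀ a b c e → (a ℤ.- b) ℤ.+ (c ℤ.- e) ≡ (a ℤ.+ c) ℤ.- (b ℤ.+ e)
      rearrange = ℤ-Solver.solve-∀

  powZ-neg : ∀ x → powZ q (ℤ.- x) ≡ inv (powZ q x)
  powZ-neg x = sym (inv-unique (powZ q x) (begin
    powZ q x * powZ q (ℤ.- x)   ≡⟨ sym (powZ-distribˡ-+-* x (ℤ.- x)) ⟩
    powZ q (x ℤ.+ ℤ.- x)        ≡⟨ cong (powZ q) (ℤP.+-inverseʳ x) ⟩
    1ℚ                          ∎))

  powN-powZ : ∀ x k → powN (powZ q x) k ≡ powZ q (x ℤ.* + k)
  powN-powZ x zero    = cong (powZ q) (sym (ℤP.*-zeroʳ x))
  powN-powZ x (suc k) = begin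
    powZ q x * powN (powZ q x) k   ≡⟨ cong (powZ q x *_) (powN-powZ x k) ⟩
    powZ q x * powZ q (x ℤ.* + k)  ≡⟨ sym (powZ-distribˡ-+-* x (x ℤ.* + k)) ⟩
    powZ q (x ℤ.+ x ℤ.* + k)       ≡⟨ cong (powZ q) (sym (ℤP.*-suc x (+ k))) ⟩
    powZ q (x ℤ.* + suc k)         ∎

  powZ-*-assoc : ∀ x y → powZ (powZ q x) y ≡ powZ q (x ℤ.* y)
  powZ-*-assoc x (+ k)    = powN-powZ x k
  powZ-*-assoc x -[1+ k ] = begin
    inv (powN (powZ q x) (suc k))   ≡⟨ cong inv (powN-powZ x (suc k)) ⟩
    inv (powZ q (x ℤ.* + suc k))    ≡⟨ sym (powZ-neg (x ℤ.* + suc k)) ⟩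
    powZ q (ℤ.- (x ℤ.* + suc k))    ≡⟨ cong (powZ q) (ℤP.neg-distribʳ-* x (+ suc k)) ⟩
    powZ q (x ℤ.* -[1+ k ])         ∎

-- q-shifted factorials

qpoch-+ : ∀ x p m n → qpoch x p (m ℕ.+ n) ≡ qpoch x p m * qpoch (x * powN p m) p n
qpoch-+ x p m n = trans (prodR-+ m n _) (cong (qpoch x p m *_) (prodR-cong n (λ i _ →
  cong (λ t → 1ℚ - t) (trans (cong (x *_) (powN-distribˡ-+-* p m i)) (sym (*-assoc x (powN p m) (powN p i)))))))

qpoch-swap : ∀ x p m k → qpoch (x * powN p m) p k * qpoch x p m ≡ qpoch x p k * qpoch (x * powN p k) p m
qpoch-swap x p m k = begin
  qpoch (x * powN p m) p k * qpoch x p m   ≡⟨ *-comm (qpoch (x * powN p m) p k) (qpoch x p m) ⟩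
  qpoch x p m * qpoch (x * powN p m) p k   ≡⟨ sym (qpoch-+ x p m k) ⟩
  qpoch x p (m ℕ.+ k)                      ≡⟨ cong (qpoch x p) (ℕP.+-comm m k) ⟩
  qpoch x p (k ℕ.+ m)                      ≡⟨ qpoch-+ x p k m ⟩
  qpoch x p k * qpoch (x * powN p k) p m   ∎

qpoch-vanishes : ∀ {N} u p k → u * powN p N ≡ 1ℚ → N < k → qpoch u p k ≡ 0ℚ
qpoch-vanishes {N} u p (suc k) u·pᴺ≡1 N<1+k with ℕP.m<1+n⇒m<n∨m≡n N<1+k
... | inj₁ N<k  = trans (cong (_* (1ℚ - u * powN p k)) (qpoch-vanishes u p k u·pᴺ≡1 N<k)) (*-zeroˡ (1ℚ - u * powN p k))
... | inj₂ refl = trans (cong (λ t → qpoch u p N * (1ℚ - t)) u·pᴺ≡1) (*-zeroʳ (qpoch u p N))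

qpochProd : ℕ → (ℕ → ℚ) → ℚ → ℕ → ℚ
qpochProd J z p k = prodR J (λ i → qpoch (z i) p k)

qpochProd-swap : ∀ J z p m k →
  qpochProd J (λ i → z i * powN p m) p k * qpochProd J z p m ≡ qpochProd J z p k * qpochProd J (λ i → z i * powN p k) p m
qpochProd-swap J z p m k =
  trans (sym (prodR-distrib-* J _ _)) (trans (prodR-cong J (λ i _ → qpoch-swap (z i) p m k)) (prodR-distrib-* J _ _))

-- The terminating q-binomial series

module QBinomialSeries (p u : ℚ) (N n : ℕ) (u·pᴺ≡1 : u * powN p N ≡ 1ℚ) (N<n : N < n)
                   (qpoch-p≢0 : ∀ k → k < n → qpoch p p k ≢ 0ℚ) where

  c : ℕ → ℚ
  c k = qpoch u p k * inv (qpoch p p k)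

  M : ℚ → ℚ
  M y = sumR n (λ k → c k * powN y k)

  c-vanishes : c n ≡ 0ℚ
  c-vanishes = trans (cong (_* inv (qpoch p p n)) (qpoch-vanishes u p n u·pᴺ≡1 N<n)) (*-zeroˡ (inv (qpoch p p n)))

  c-recurrence : ∀ k → c (suc k) * (1ℚ - powN p (suc k)) ≡ c k * (1ℚ - u * powN p k)
  c-recurrence k = begin
    c (suc k) * z                                     ≡⟨ cong (λ t → qpoch u p (suc k) * t * z) (inv-distrib-* (qpoch p p k) z) ⟩
    qpoch u p (suc k) * (inv (qpoch p p k) * inv z) * z ≡⟨ cong (_* z) (sym (*-assoc (qpoch u p (suc k)) _ _)) ⟩
    x * inv z * z                                     ≡⟨ x*inv[z]*z≡x x z z≡0⇒x≡0 ⟩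
    x                                                 ≡⟨ rearrange (qpoch u p k) (1ℚ - u * powN p k) (inv (qpoch p p k)) ⟩
    c k * (1ℚ - u * powN p k)                         ∎
    where
    z x : ℚ
    z = 1ℚ - powN p (suc k)
    x = qpoch u p (suc k) * inv (qpoch p p k)
    rearrange : ∀ a b i → (a * b) * i ≡ (a * i) * b
    rearrange = solve-∀ ℚ-ring
    -- If 1 − p^(k+1) = 0 then (p;p)_(k+1) = 0, so k + 1 ≥ n > N and (u;p)_(k+1) = 0 as well.
    z≡0⇒x≡0 : z ≡ 0ℚ → x ≡ 0ℚ
    z≡0⇒x≡0 z≡0 = trans (cong (_* inv (qpoch p p k)) (qpoch-vanishes u p (suc k) u·pᴺ≡1 N<1+k))
                        (*-zeroˡ (inv (qpoch p p k)))
      where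
      n≤1+k : n ≤ suc k
      n≤1+k = ℕP.≮⇒≥ (λ 1+k<n → qpoch-p≢0 (suc k) 1+k<n (trans (cong (qpoch p p k *_) z≡0) (*-zeroʳ (qpoch p p k))))
      N<1+k : N < suc k
      N<1+k = ℕP.<-≤-trans N<n n≤1+k

  Δ : ℚ → ℚ
  Δ y = sumR n (λ k → c k * powN y k * (1ℚ - powN p k))

  Δ+M[py]≡M[y] : ∀ y → Δ y + M (p * y) ≡ M y
  Δ+M[py]≡M[y] y = begin
    Δ y + M (p * y)                                                       ≡⟨ sym (sumR-distrib-+ n _ _) ⟩
    sumR n (λ k → c k * powN y k * (1ℚ - powN p k) + c k * powN (p * y) k) ≡⟨ sumR-cong n (λ k _ → term k) ⟩
    M y                                                                   ∎
    where
    split : ∀ c Y P → c * Y * (1ℚ - P) + c * (P * Y) ≡ c * Y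
    split = solve-∀ ℚ-ring
    term : ∀ k → c k * powN y k * (1ℚ - powN p k) + c k * powN (p * y) k ≡ c k * powN y k
    term k = trans (cong (λ t → c k * powN y k * (1ℚ - powN p k) + c k * t) (powN-distribʳ-* p y k))
                   (split (c k) (powN y k) (powN p k))

  Δ+uyM[py]≡yM[y] : ∀ y → Δ y + (u * y) * M (p * y) ≡ y * M y
  Δ+uyM[py]≡yM[y] y = begin
    Δ y + (u * y) * M (p * y)
      ≡⟨ cong (_+ (u * y) * M (p * y)) (sumR-reindex n h h0≡0 hn≡0) ⟩
    sumR n (λ k → h (suc k)) + (u * y) * M (p * y)
      ≡⟨ cong (λ t → sumR n (λ k → h (suc k)) + t) (sym (sumR-*ˡ n (u * y) _)) ⟩
    sumR n (λ k → h (suc k)) + sumR n (λ k → (u * y) * (c k * powN (p * y) k))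
      ≡⟨ sym (sumR-distrib-+ n _ _) ⟩
    sumR n (λ k → h (suc k) + (u * y) * (c k * powN (p * y) k))
      ≡⟨ sumR-cong n (λ k _ → term k) ⟩
    sumR n (λ k → y * (c k * powN y k))
      ≡⟨ sumR-*ˡ n y _ ⟩
    y * M y ∎
    where
    h : ℕ → ℚ
    h k = c k * powN y k * (1ℚ - powN p k)
    h0≡0 : h 0 ≡ 0ℚ
    h0≡0 = vanish (c 0)
      where
      vanish : ∀ a → a * 1ℚ * (1ℚ - 1ℚ) ≡ 0ℚ
      vanish = solve-∀ ℚ-ring
    hn≡0 : h n ≡ 0ℚ
    hn≡0 = begin
      c n * powN y n * (1ℚ - powN p n)   ≡⟨ cong (λ t → t * powN y n * (1ℚ - powN p n)) c-vanishes ⟩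
      0ℚ * powN y n * (1ℚ - powN p n)    ≡⟨ cong (_* (1ℚ - powN p n)) (*-zeroˡ (powN y n)) ⟩
      0ℚ * (1ℚ - powN p n)               ≡⟨ *-zeroˡ (1ℚ - powN p n) ⟩
      0ℚ                                 ∎
    rearrange : ∀ C y Y z → C * (y * Y) * (1ℚ - z) ≡ (C * (1ℚ - z)) * (y * Y)
    rearrange = solve-∀ ℚ-ring
    expand : ∀ c u P y Y → (c * (1ℚ - u * P)) * (y * Y) + (u * y) * (c * (P * Y)) ≡ y * (c * Y)
    expand = solve-∀ ℚ-ring
    term : ∀ k → h (suc k) + (u * y) * (c k * powN (p * y) k) ≡ y * (c k * powN y k)
    term k = begin
      h (suc k) + (u * y) * (c k * powN (p * y) k)
        ≡⟨ cong₂ _+_ (rearrange (c (suc k)) y (powN y k) (powN p (suc k)))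
                     (cong (λ t → (u * y) * (c k * t)) (powN-distribʳ-* p y k)) ⟩
      (c (suc k) * (1ℚ - powN p (suc k))) * (y * powN y k) + (u * y) * (c k * (powN p k * powN y k))
        ≡⟨ cong (λ t → t * (y * powN y k) + (u * y) * (c k * (powN p k * powN y k))) (c-recurrence k) ⟩
      (c k * (1ℚ - u * powN p k)) * (y * powN y k) + (u * y) * (c k * (powN p k * powN y k))
        ≡⟨ expand (c k) u (powN p k) y (powN y k) ⟩
      y * (c k * powN y k) ∎

  M-functional : ∀ y → M y * (1ℚ - y) ≡ M (p * y) * (1ℚ - u * y)
  M-functional y = begin
    M y * (1ℚ - y)                                     ≡⟨ expand (M y) y ⟩
    M y - y * M y                                      ≡⟨ cong₂ _-_ (sym (Δ+M[py]≡M[y] y)) (sym (Δ+uyM[py]≡yM[y] y)) ⟩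
    (Δ y + M (p * y)) - (Δ y + (u * y) * M (p * y))    ≡⟨ collect (Δ y) (M (p * y)) u y ⟩
    M (p * y) * (1ℚ - u * y)                           ∎
    where
    expand : ∀ A y → A * (1ℚ - y) ≡ A - y * A
    expand = solve-∀ ℚ-ring
    collect : ∀ D P u y → (D + P) - (D + (u * y) * P) ≡ P * (1ℚ - u * y)
    collect = solve-∀ ℚ-ring

  -- Downward induction from j = N, where the factor 1 − u p^N of M-functional vanishes.
  M-vanishes : ∀ j → suc j ≤ N → M (powN p (suc j)) ≡ 0ℚ
  M-vanishes j 1+j≤N = downward (N ℕ.∸ suc j) j (ℕP.m+[n∸m]≡n 1+j≤N)
    where
    step : ∀ s → suc s ≤ N → M (p * powN p (suc s)) * (1ℚ - u * powN p (suc s)) ≡ 0ℚ → M (powN p (suc s)) ≡ 0ℚ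
    step s 1+s≤N rhs≡0 =
      x*y≡0⇒y≡0 1-pˢ≢0 (trans (*-comm (1ℚ - powN p (suc s)) _) (trans (M-functional (powN p (suc s))) rhs≡0))
      where
      1-pˢ≢0 : 1ℚ - powN p (suc s) ≢ 0ℚ
      1-pˢ≢0 = x*y≢0⇒y≢0 (qpoch p p s) (qpoch-p≢0 (suc s) (ℕP.<-≤-trans (s≤s 1+s≤N) N<n))
    downward : ∀ t s → suc s ℕ.+ t ≡ N → M (powN p (suc s)) ≡ 0ℚ
    downward zero s 1+s≡N = step s (ℕP.≤-reflexive 1+s≡N′) (begin
      M (p * y) * (1ℚ - u * powN p (suc s)) ≡⟨ cong (λ t → M (p * y) * (1ℚ - u * powN p t)) 1+s≡N′ ⟩
      M (p * y) * (1ℚ - u * powN p N)       ≡⟨ cong (λ t → M (p * y) * (1ℚ - t)) u·pᴺ≡1 ⟩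
      M (p * y) * (1ℚ - 1ℚ)                 ≡⟨ vanish (M (p * y)) ⟩
      0ℚ                                    ∎)
      where
      y : ℚ
      y = powN p (suc s)
      1+s≡N′ : suc s ≡ N
      1+s≡N′ = trans (sym (ℕP.+-identityʳ (suc s))) 1+s≡N
      vanish : ∀ a → a * (1ℚ - 1ℚ) ≡ 0ℚ
      vanish = solve-∀ ℚ-ring
    downward (suc t) s 1+s+1+t≡N = step s (ℕP.m+n≤o⇒m≤o (suc s) (ℕP.≤-reflexive 1+s+1+t≡N))
      (trans (cong (_* (1ℚ - u * powN p (suc s))) (downward t (suc s) (trans (sym (ℕP.+-suc (suc s) t)) 1+s+1+t≡N)))
             (*-zeroˡ (1ℚ - u * powN p (suc s))))

  moment : ℕ → (ℚ → ℚ) → ℚ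
  moment j f = sumR n (λ k → c k * powN (powN p j) k * f (powN p k))

  -- Holds for every polynomial f of degree ≤ D, since the moment j of x ↦ x^i is M (p^(i+j)) and
  -- M vanishes at p, …, p^N.
  record Annihilated (D : ℕ) (f : ℚ → ℚ) : Set where
    constructor annihilated
    field vanishes : ∀ j → suc j ℕ.+ D ≤ N → moment (suc j) f ≡ 0ℚ
  open Annihilated

  annihilated-1 : Annihilated 0 (λ _ → 1ℚ)
  annihilated-1 = annihilated (λ j 1+j+0≤N →
    trans (sumR-cong n (λ k _ → *-identityʳ _)) (M-vanishes j (ℕP.≤-trans (ℕP.m≤m+n (suc j) 0) 1+j+0≤N)))

  annihilated-≤ : ∀ {D D′ f} → D ≤ D′ → Annihilated D f → Annihilated D′ f
  annihilated-≤ D≤D′ ann =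
    annihilated (λ j 1+j+D′≤N → vanishes ann j (ℕP.≤-trans (ℕP.+-monoʳ-≤ (suc j) D≤D′) 1+j+D′≤N))

  annihilated-cong : ∀ {D f g} → (∀ x → f x ≡ g x) → Annihilated D f → Annihilated D g
  annihilated-cong f≗g ann = annihilated (λ j le →
    trans (sumR-cong n (λ k _ → cong (c k * powN (powN p (suc j)) k *_) (sym (f≗g (powN p k))))) (vanishes ann j le))

  annihilated-linear : ∀ {D f} → Annihilated D f → ∀ β → Annihilated (suc D) (λ x → f x * (1ℚ - β * x))
  annihilated-linear {D} {f} ann β = annihilated vanishing
    where
    vanishing : ∀ j → suc j ℕ.+ suc D ≤ N → moment (suc j) (λ x → f x * (1ℚ - β * x)) ≡ 0ℚ
    vanishing j 1+j+1+D≤N = begin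
      moment (suc j) (λ x → f x * (1ℚ - β * x))
        ≡⟨ sumR-cong n (λ k _ → term k) ⟩
      sumR n (λ k → c k * W k * f (powN p k) + (- β) * (c k * powN (powN p (suc (suc j))) k * f (powN p k)))
        ≡⟨ sumR-distrib-+ n _ _ ⟩
      moment (suc j) f + sumR n (λ k → (- β) * (c k * powN (powN p (suc (suc j))) k * f (powN p k)))
        ≡⟨ cong (λ t → moment (suc j) f + t) (sumR-*ˡ n (- β) _) ⟩
      moment (suc j) f + (- β) * moment (suc (suc j)) f
        ≡⟨ cong₂ (λ a b → a + (- β) * b) (vanishes ann j 1+j+D≤N) (vanishes ann (suc j) 2+j+D≤N) ⟩
      0ℚ + (- β) * 0ℚ
        ≡⟨ vanish β ⟩
      0ℚ ∎
      where
      W : ℕ → ℚ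
      W k = powN (powN p (suc j)) k
      2+j+D≤N : suc (suc j) ℕ.+ D ≤ N
      2+j+D≤N = ℕP.≤-trans (ℕP.≤-reflexive (sym (ℕP.+-suc (suc j) D))) 1+j+1+D≤N
      1+j+D≤N : suc j ℕ.+ D ≤ N
      1+j+D≤N = ℕP.≤-trans (ℕP.n≤1+n _) 2+j+D≤N
      vanish : ∀ β → 0ℚ + (- β) * 0ℚ ≡ 0ℚ
      vanish = solve-∀ ℚ-ring
      expand : ∀ c w F β P → c * w * (F * (1ℚ - β * P)) ≡ c * w * F + (- β) * (c * (P * w) * F)
      expand = solve-∀ ℚ-ring
      term : ∀ k → c k * W k * (f (powN p k) * (1ℚ - β * powN p k))
                 ≡ c k * W k * f (powN p k) + (- β) * (c k * powN (powN p (suc (suc j))) k * f (powN p k))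
      term k = trans (expand (c k) (W k) (f (powN p k)) β (powN p k))
                     (cong (λ t → c k * W k * f (powN p k) + (- β) * (c k * t * f (powN p k)))
                           (sym (powN-distribʳ-* p (powN p (suc j)) k)))

  annihilated-qpoch : ∀ {D f} → Annihilated D f → ∀ b m → Annihilated (D ℕ.+ m) (λ x → f x * qpoch (b * x) p m)
  annihilated-qpoch {D} ann b zero = annihilated-≤ (ℕP.m≤m+n D 0) (annihilated-cong (λ x → sym (*-identityʳ _)) ann)
  annihilated-qpoch {D} {f} ann b (suc m) =
    annihilated-≤ (ℕP.≤-reflexive (sym (ℕP.+-suc D m)))
      (annihilated-cong (λ x → rearrange (f x) (qpoch (b * x) p m) b x (powN p m))
        (annihilated-linear (annihilated-qpoch ann b m) (b * powN p m)))
    where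
    rearrange : ∀ F Q b x P → F * Q * (1ℚ - (b * P) * x) ≡ F * (Q * (1ℚ - b * x * P))
    rearrange = solve-∀ ℚ-ring

  annihilated-qpochProd : ∀ {D f} → Annihilated D f → ∀ J (z : ℕ → ℚ) m →
    Annihilated (D ℕ.+ J ℕ.* m) (λ x → f x * qpochProd J (λ i → z i * x) p m)
  annihilated-qpochProd {D} ann zero z m =
    annihilated-≤ (ℕP.m≤m+n D 0) (annihilated-cong (λ x → sym (*-identityʳ _)) ann)
  annihilated-qpochProd {D} {f} ann (suc J) z m =
    annihilated-≤ (ℕP.≤-reflexive (degree D J m))
      (annihilated-cong {g = λ x → f x * qpochProd (suc J) (λ i → z i * x) p m}
        (λ x → *-assoc (f x) (qpochProd J (λ i → z i * x) p m) (qpoch (z J * x) p m))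
        (annihilated-qpoch (annihilated-qpochProd ann J z m) (z J) m))
    where
    degree : ∀ D J m → D ℕ.+ J ℕ.* m ℕ.+ m ≡ D ℕ.+ suc J ℕ.* m
    degree = ℕ-Solver.solve-∀

terminating-sum-vanishes : ∀ (p u : ℚ) (N n m J₁ J₂ : ℕ) (X Y : ℕ → ℚ) →
  u * powN p N ≡ 1ℚ → N < n → m < n → (J₁ ℕ.+ J₂) ℕ.* m < N →
  (∀ k → k < n → qpoch p p k * (qpochProd J₁ X p k * qpochProd J₂ Y p k) ≢ 0ℚ) →
  sumR n (λ k → qpoch u p k * powN p k * (qpochProd J₁ (λ i → X i * powN p m) p k * qpochProd J₂ (λ i → Y i * powN p m) p k)
                * inv (qpoch p p k * (qpochProd J₁ X p k * qpochProd J₂ Y p k))) ≡ 0ℚ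
terminating-sum-vanishes p u N n m J₁ J₂ X Y u·pᴺ≡1 N<n m<n degree<N den≢0 =
  x*y≡0⇒y≡0 K≢0 (begin
    K * sumR n T                ≡⟨ sym (sumR-*ˡ n K T) ⟩
    sumR n (λ k → K * T k)      ≡⟨ sumR-cong n K*T≡c*pᵏ*R ⟩
    moment 1 R                  ≡⟨ vanishes R-annihilated 0 1+degree≤N ⟩
    0ℚ                          ∎)
  where
  open QBinomialSeries p u N n u·pᴺ≡1 N<n (λ k k<n → x*y≢0⇒x≢0 _ (den≢0 k k<n))
  open Annihilated

  P Q : ℕ → ℚ
  P k = qpochProd J₁ X p k * qpochProd J₂ Y p k
  Q k = qpochProd J₁ (λ i → X i * powN p m) p k * qpochProd J₂ (λ i → Y i * powN p m) p k

  T : ℕ → ℚ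
  T k = qpoch u p k * powN p k * Q k * inv (qpoch p p k * P k)

  K : ℚ
  K = P m

  K≢0 : K ≢ 0ℚ
  K≢0 = x*y≢0⇒y≢0 (qpoch p p m) (den≢0 m m<n)

  R : ℚ → ℚ
  R x = 1ℚ * qpochProd J₁ (λ i → X i * x) p m * qpochProd J₂ (λ i → Y i * x) p m

  R-annihilated : Annihilated (0 ℕ.+ J₁ ℕ.* m ℕ.+ J₂ ℕ.* m) R
  R-annihilated = annihilated-qpochProd (annihilated-qpochProd annihilated-1 J₁ X m) J₂ Y m

  1+degree≤N : 1 ℕ.+ (0 ℕ.+ J₁ ℕ.* m ℕ.+ J₂ ℕ.* m) ≤ N
  1+degree≤N = ℕP.≤-trans (ℕP.≤-reflexive (cong suc (sym (ℕP.*-distribʳ-+ m J₁ J₂)))) degree<N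

  K*T≡c*pᵏ*R : ∀ k → k < n → K * T k ≡ c k * powN (powN p 1) k * R (powN p k)
  K*T≡c*pᵏ*R k k<n = begin
    (PXm * PYm) * (A * powN p k * (QXk * QYk) * inv (qpoch p p k * (PXk * PYk)))
      ≡⟨ cong (λ t → (PXm * PYm) * (A * powN p k * (QXk * QYk) * t)) (inv-distrib-* (qpoch p p k) (PXk * PYk)) ⟩
    (PXm * PYm) * (A * powN p k * (QXk * QYk) * (inv (qpoch p p k) * inv (PXk * PYk)))
      ≡⟨ regroup PXm PYm A (powN p k) QXk QYk (inv (qpoch p p k)) (inv (PXk * PYk)) ⟩
    (A * inv (qpoch p p k)) * powN p k * ((QXk * PXm) * (QYk * PYm)) * inv (PXk * PYk)
      ≡⟨ cong₂ (λ a b → c k * powN p k * (a * b) * inv (PXk * PYk))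
               (qpochProd-swap J₁ X p m k) (qpochProd-swap J₂ Y p m k) ⟩
    c k * powN p k * ((PXk * RXk) * (PYk * RYk)) * inv (PXk * PYk)
      ≡⟨ separate (c k) (powN p k) PXk RXk PYk RYk (inv (PXk * PYk)) ⟩
    c k * powN p k * R (powN p k) * ((PXk * PYk) * inv (PXk * PYk))
      ≡⟨ cong (c k * powN p k * R (powN p k) *_) (inv-inverseʳ (x*y≢0⇒y≢0 (qpoch p p k) (den≢0 k k<n))) ⟩
    c k * powN p k * R (powN p k) * 1ℚ
      ≡⟨ *-identityʳ _ ⟩
    c k * powN p k * R (powN p k)
      ≡⟨ cong (λ t → c k * powN t k * R (powN p k)) (sym (*-identityʳ p)) ⟩
    c k * powN (powN p 1) k * R (powN p k) ∎
    where
    A PXk PYk PXm PYm QXk QYk RXk RYk : ℚ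
    A = qpoch u p k
    PXk = qpochProd J₁ X p k
    PYk = qpochProd J₂ Y p k
    PXm = qpochProd J₁ X p m
    PYm = qpochProd J₂ Y p m
    QXk = qpochProd J₁ (λ i → X i * powN p m) p k
    QYk = qpochProd J₂ (λ i → Y i * powN p m) p k
    RXk = qpochProd J₁ (λ i → X i * powN p k) p m
    RYk = qpochProd J₂ (λ i → Y i * powN p k) p m
    regroup : ∀ PXm PYm A w QXk QYk iB iP →
      (PXm * PYm) * (A * w * (QXk * QYk) * (iB * iP)) ≡ (A * iB) * w * ((QXk * PXm) * (QYk * PYm)) * iP
    regroup = solve-∀ ℚ-ring
    separate : ∀ c w PXk RXk PYk RYk iP →
      c * w * ((PXk * RXk) * (PYk * RYk)) * iP ≡ c * w * (1ℚ * RXk * RYk) * ((PXk * PYk) * iP)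
    separate = solve-∀ ℚ-ring

-- Specialisation to p = q^d, a = q^(±n)

module Specialisation {q : ℚ} (q≢0 : q ≢ 0ℚ) (d m N : ℕ) where

  n : ℕ
  n = N ℕ.+ suc m

  r : ℤ
  r = + (suc m ℕ.* d) ℤ.- + n

  a p : ℚ
  a = powZ q (+ n)
  p = powN q d

  a≢0 : a ≢ 0ℚ
  a≢0 = powN-≢0 n q≢0

  a·qʳ≡pᵐ⁺¹ : a * powZ q r ≡ p * powN p m
  a·qʳ≡pᵐ⁺¹ = begin
    powZ q (+ n) * powZ q r   ≡⟨ sym (powZ-distribˡ-+-* q≢0 (+ n) r) ⟩
    powZ q (+ n ℤ.+ r)        ≡⟨ cong (powZ q) (cancel (+ n) (+ (suc m ℕ.* d))) ⟩
    powN q (suc m ℕ.* d)      ≡⟨ cong (powN q) (ℕP.*-comm (suc m) d) ⟩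
    powN q (d ℕ.* suc m)      ≡⟨ sym (powN-*-assoc q d (suc m)) ⟩
    powN p (suc m)            ∎
    where
    cancel : ∀ x y → x ℤ.+ (y ℤ.- x) ≡ y
    cancel = ℤ-Solver.solve-∀

  a^[t+1]·qʳ≡a^t·pᵐ⁺¹ : ∀ s t → s ≡ t ℤ.+ + 1 → powZ a s * powZ q r ≡ powZ a t * p * powN p m
  a^[t+1]·qʳ≡a^t·pᵐ⁺¹ s t refl = begin
    powZ a (t ℤ.+ + 1) * powZ q r        ≡⟨ cong (_* powZ q r) (powZ-distribˡ-+-* a≢0 t (+ 1)) ⟩
    powZ a t * (a * 1ℚ) * powZ q r       ≡⟨ regroup (powZ a t) a (powZ q r) ⟩
    powZ a t * (a * powZ q r)            ≡⟨ cong (powZ a t *_) a·qʳ≡pᵐ⁺¹ ⟩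
    powZ a t * (p * powN p m)            ≡⟨ sym (*-assoc (powZ a t) p (powN p m)) ⟩
    powZ a t * p * powN p m              ∎
    where
    regroup : ∀ x a y → x * (a * 1ℚ) * y ≡ x * (a * y)
    regroup = solve-∀ ℚ-ring

  a⁻ᵈ·pⁿ≡1 : powZ a (ℤ.- + d) * powN p n ≡ 1ℚ
  a⁻ᵈ·pⁿ≡1 = begin
    powZ a (ℤ.- + d) * powN p n          ≡⟨ cong₂ _*_ (powZ-neg a≢0 (+ d)) (powN-*-assoc q d n) ⟩
    inv (powN a d) * powN q (d ℕ.* n)    ≡⟨ cong (λ t → inv t * powN q (d ℕ.* n)) (powN-*-assoc q n d) ⟩
    inv (powN q (n ℕ.* d)) * powN q (d ℕ.* n) ≡⟨ cong (λ t → inv (powN q (n ℕ.* d)) * powN q t) (ℕP.*-comm d n) ⟩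
    inv (powN q (n ℕ.* d)) * powN q (n ℕ.* d) ≡⟨ *-comm (inv (powN q (n ℕ.* d))) _ ⟩
    powN q (n ℕ.* d) * inv (powN q (n ℕ.* d)) ≡⟨ inv-inverseʳ (powN-≢0 (n ℕ.* d) q≢0) ⟩
    1ℚ                                   ∎

  a^s·qʳ·pᴺ≡1 : ∀ s → s ≡ ℤ.- + d ℤ.+ + 1 → powZ a s * powZ q r * powN p N ≡ 1ℚ
  a^s·qʳ·pᴺ≡1 s s≡1-d = begin
    powZ a s * powZ q r * powN p N                ≡⟨ cong (_* powN p N) (a^[t+1]·qʳ≡a^t·pᵐ⁺¹ s (ℤ.- + d) s≡1-d) ⟩
    powZ a (ℤ.- + d) * p * powN p m * powN p N    ≡⟨ regroup (powZ a (ℤ.- + d)) p (powN p m) (powN p N) ⟩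
    powZ a (ℤ.- + d) * (p * powN p m * powN p N)  ≡⟨ cong (powZ a (ℤ.- + d) *_) (sym (powN-distribˡ-+-* p (suc m) N)) ⟩
    powZ a (ℤ.- + d) * powN p (suc m ℕ.+ N)       ≡⟨ cong (λ t → powZ a (ℤ.- + d) * powN p t) (ℕP.+-comm (suc m) N) ⟩
    powZ a (ℤ.- + d) * powN p n                   ≡⟨ a⁻ᵈ·pⁿ≡1 ⟩
    1ℚ                                            ∎
    where
    regroup : ∀ x p y z → x * p * y * z ≡ x * (p * y * z)
    regroup = solve-∀ ℚ-ring

[1+2*j]/2≡j : ∀ j → suc (2 ℕ.* j) ℕ./ 2 ≡ j
[1+2*j]/2≡j j = begin
  suc (2 ℕ.* j) ℕ./ 2     ≡⟨ cong (λ t → suc t ℕ./ 2) (ℕP.*-comm 2 j) ⟩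
  (1 ℕ.+ j ℕ.* 2) ℕ./ 2   ≡⟨ +-distrib-/-∣ʳ 1 {d = 2} (divides-refl j) ⟩
  0 ℕ.+ j ℕ.* 2 ℕ./ 2     ≡⟨ m*n/n≡m j 2 ⟩
  j                       ∎

module Odd {q : ℚ} (q≢0 : q ≢ 0ℚ) (J m N : ℕ) where

  d : ℕ
  d = suc (2 ℕ.* J)

  open Specialisation q≢0 d m N public

  -- The numerator parameters a^(2j) q^r (1 ≤ j ≤ J) and a^(−2j) q^r (0 ≤ j < J) are
  -- X (j − 1) p^m and Y j p^m; the remaining one, a^(−2J) q^r, is u.
  X Y : ℕ → ℚ
  X i = powZ a (2j-1 (suc i)) * p
  Y i = powZ a (1-2j (suc i)) * p

  u : ℚ
  u = powZ a (ℤ.- 2j J) * powZ q r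

  oddDen≡ : ∀ k → oddDen d r a q k ≡ qpoch p p k * (qpochProd J X p k * qpochProd J Y p k)
  oddDen≡ k = cong (qpoch p p k *_) (trans (cong (λ l → prodR l (λ i → qpoch (X i) p k * qpoch (Y i) p k)) ([1+2*j]/2≡j J))
                                           (prodR-distrib-* J _ _))

  oddNum≡ : ∀ k → oddNum d r a q k ≡
    qpoch u p k * powN p k * (qpochProd J (λ i → X i * powN p m) p k * qpochProd J (λ i → Y i * powN p m) p k)
  oddNum≡ k = begin
    qpoch (powZ q r) p k * powN q (d ℕ.* k) * prodR (d ℕ./ 2) (λ i → F i * G (suc i))
      ≡⟨ cong₂ (λ x y → qpoch x p k * y * prodR (d ℕ./ 2) (λ i → F i * G (suc i)))
               (sym (*-identityˡ (powZ q r))) (sym (powN-*-assoc q d k)) ⟩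
    G 0 * powN p k * prodR (d ℕ./ 2) (λ i → F i * G (suc i))
      ≡⟨ cong (λ l → G 0 * powN p k * prodR l (λ i → F i * G (suc i))) ([1+2*j]/2≡j J) ⟩
    G 0 * powN p k * prodR J (λ i → F i * G (suc i))
      ≡⟨ cong (G 0 * powN p k *_) (prodR-distrib-* J F (λ i → G (suc i))) ⟩
    G 0 * powN p k * (prodR J F * prodR J (λ i → G (suc i)))
      ≡⟨ rearrange (G 0) (powN p k) (prodR J F) (prodR J (λ i → G (suc i))) ⟩
    powN p k * prodR J F * (G 0 * prodR J (λ i → G (suc i)))
      ≡⟨ cong (powN p k * prodR J F *_) (sym (prodR-suc J G)) ⟩
    powN p k * prodR J F * (prodR J G * G J)
      ≡⟨ rearrange′ (powN p k) (prodR J F) (prodR J G) (G J) ⟩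
    G J * powN p k * (prodR J F * prodR J G)
      ≡⟨ cong₂ (λ x y → G J * powN p k * (x * y)) (prodR-cong J (λ i _ → cong (λ t → qpoch t p k) (F-arg i)))
                                                  (prodR-cong J (λ i _ → cong (λ t → qpoch t p k) (G-arg i))) ⟩
    qpoch u p k * powN p k * (qpochProd J (λ i → X i * powN p m) p k * qpochProd J (λ i → Y i * powN p m) p k) ∎
    where
    F G : ℕ → ℚ
    F i = qpoch (powZ a (2j (suc i)) * powZ q r) p k
    G i = qpoch (powZ a (ℤ.- 2j i) * powZ q r) p k
    F-arg : ∀ i → powZ a (2j (suc i)) * powZ q r ≡ X i * powN p m
    F-arg i = a^[t+1]·qʳ≡a^t·pᵐ⁺¹ (2j (suc i)) (2j-1 (suc i)) (shift (2j (suc i)))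
      where
      shift : ∀ x → x ≡ (x ℤ.- + 1) ℤ.+ + 1
      shift = ℤ-Solver.solve-∀
    G-arg : ∀ i → powZ a (ℤ.- 2j i) * powZ q r ≡ Y i * powN p m
    G-arg i = a^[t+1]·qʳ≡a^t·pᵐ⁺¹ (ℤ.- 2j i) (1-2j (suc i))
                (trans (shift (2j i)) (cong (λ t → (+ 1 ℤ.- t) ℤ.+ + 1) (cong +_ (sym (ℕP.*-suc 2 i)))))
      where
      shift : ∀ x → ℤ.- x ≡ (+ 1 ℤ.- (+ 2 ℤ.+ x)) ℤ.+ + 1
      shift = ℤ-Solver.solve-∀
    rearrange : ∀ g w f h → g * w * (f * h) ≡ w * f * (g * h)
    rearrange = solve-∀ ℚ-ring
    rearrange′ : ∀ w f h g → w * f * (h * g) ≡ g * w * (f * h)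
    rearrange′ = solve-∀ ℚ-ring

  oddSum-vanishes : (d ℕ.∸ 1) ℕ.* m < N → (∀ k → k < n → oddDen d r a q k ≢ 0ℚ) → oddSum d r n a q ≡ 0ℚ
  oddSum-vanishes degree<N den≢0 =
    trans (sumR-cong n (λ k _ → cong₂ (λ x y → x * inv y) (oddNum≡ k) (oddDen≡ k)))
          (terminating-sum-vanishes p u N n m J J X Y
             (a^s·qʳ·pᴺ≡1 _ (shift (2j J))) (ℕP.m<m+n N (s≤s z≤n)) (ℕP.m≤n+m (suc m) N)
             (subst (λ e → e ℕ.* m < N) (cong (J ℕ.+_) (ℕP.+-identityʳ J)) degree<N)
             (λ k k<n den≡0 → den≢0 k k<n (trans (oddDen≡ k) den≡0)))
    where
    shift : ∀ x → ℤ.- x ≡ ℤ.- (+ 1 ℤ.+ x) ℤ.+ + 1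
    shift = ℤ-Solver.solve-∀

[2*j]/2≡j : ∀ j → 2 ℕ.* j ℕ./ 2 ≡ j
[2*j]/2≡j j = trans (cong (ℕ._/ 2) (ℕP.*-comm 2 j)) (m*n/n≡m j 2)

module Even {q : ℚ} (q≢0 : q ≢ 0ℚ) (J m N : ℕ) where

  d : ℕ
  d = 2 ℕ.* suc J

  open Specialisation q≢0 d m N public

  -- The numerator parameters a^(2j−1) q^r (1 ≤ j ≤ J + 1) and a^(1−2j) q^r (1 ≤ j ≤ J) are
  -- X (j − 1) p^m and Y (j − 1) p^m; the remaining one, a^(−2J−1) q^r, is u.  The factor
  -- (p;p)_k is the j = 0 factor (a^(−2j) p;p)_k of the denominator.
  X Y : ℕ → ℚ
  X i = powZ a (2j i) * p
  Y i = powZ a (ℤ.- 2j (suc i)) * p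

  u : ℚ
  u = powZ a (1-2j (suc J)) * powZ q r

  evenDen≡ : ∀ k → evenDen d r a q k ≡ qpoch p p k * (qpochProd (suc J) X p k * qpochProd J Y p k)
  evenDen≡ k = begin
    prodR (d ℕ./ 2) (λ i → qpoch (X i) p k * H i)
      ≡⟨ cong (λ l → prodR l (λ i → qpoch (X i) p k * H i)) ([2*j]/2≡j (suc J)) ⟩
    prodR (suc J) (λ i → qpoch (X i) p k * H i)
      ≡⟨ prodR-distrib-* (suc J) _ H ⟩
    qpochProd (suc J) X p k * prodR (suc J) H
      ≡⟨ cong (qpochProd (suc J) X p k *_) (prodR-suc J H) ⟩
    qpochProd (suc J) X p k * (H 0 * qpochProd J Y p k)
      ≡⟨ cong (λ t → qpochProd (suc J) X p k * (qpoch t p k * qpochProd J Y p k)) (*-identityˡ p) ⟩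
    qpochProd (suc J) X p k * (qpoch p p k * qpochProd J Y p k)
      ≡⟨ rearrange (qpochProd (suc J) X p k) (qpoch p p k) (qpochProd J Y p k) ⟩
    qpoch p p k * (qpochProd (suc J) X p k * qpochProd J Y p k) ∎
    where
    H : ℕ → ℚ
    H i = qpoch (powZ a (ℤ.- 2j i) * p) p k
    rearrange : ∀ x h y → x * (h * y) ≡ h * (x * y)
    rearrange = solve-∀ ℚ-ring

  1-x≡-x+1 : ∀ x → + 1 ℤ.- x ≡ ℤ.- x ℤ.+ + 1
  1-x≡-x+1 = ℤ-Solver.solve-∀

  evenNum≡ : ∀ k → evenNum d r a q k ≡
    qpoch u p k * powN p k * (qpochProd (suc J) (λ i → X i * powN p m) p k * qpochProd J (λ i → Y i * powN p m) p k)
  evenNum≡ k = begin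
    powN q (d ℕ.* k) * prodR (d ℕ./ 2) (λ i → E i * F i)
      ≡⟨ cong₂ (λ x l → x * prodR l (λ i → E i * F i)) (sym (powN-*-assoc q d k)) ([2*j]/2≡j (suc J)) ⟩
    powN p k * prodR (suc J) (λ i → E i * F i)
      ≡⟨ cong (powN p k *_) (prodR-distrib-* (suc J) E F) ⟩
    powN p k * (prodR (suc J) E * (prodR J F * F J))
      ≡⟨ rearrange (powN p k) (prodR (suc J) E) (prodR J F) (F J) ⟩
    F J * powN p k * (prodR (suc J) E * prodR J F)
      ≡⟨ cong₂ (λ x y → F J * powN p k * (x * y)) (prodR-cong (suc J) (λ i _ → cong (λ t → qpoch t p k) (E-arg i)))
                                                  (prodR-cong J (λ i _ → cong (λ t → qpoch t p k) (F-arg i))) ⟩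
    qpoch u p k * powN p k * (qpochProd (suc J) (λ i → X i * powN p m) p k * qpochProd J (λ i → Y i * powN p m) p k) ∎
    where
    E F : ℕ → ℚ
    E i = qpoch (powZ a (2j-1 (suc i)) * powZ q r) p k
    F i = qpoch (powZ a (1-2j (suc i)) * powZ q r) p k
    E-arg : ∀ i → powZ a (2j-1 (suc i)) * powZ q r ≡ X i * powN p m
    E-arg i = a^[t+1]·qʳ≡a^t·pᵐ⁺¹ (2j-1 (suc i)) (2j i)
                (trans (cong (λ t → t ℤ.- + 1) (cong +_ (ℕP.*-suc 2 i))) (shift (2j i)))
      where
      shift : ∀ x → (+ 2 ℤ.+ x) ℤ.- + 1 ≡ x ℤ.+ + 1
      shift = ℤ-Solver.solve-∀
    F-arg : ∀ i → powZ a (1-2j (suc i)) * powZ q r ≡ Y i * powN p m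
    F-arg i = a^[t+1]·qʳ≡a^t·pᵐ⁺¹ (1-2j (suc i)) (ℤ.- 2j (suc i)) (1-x≡-x+1 (2j (suc i)))
    rearrange : ∀ w e f g → w * (e * (f * g)) ≡ g * w * (e * f)
    rearrange = solve-∀ ℚ-ring

  evenSum-vanishes : (d ℕ.∸ 1) ℕ.* m < N → (∀ k → k < n → evenDen d r a q k ≢ 0ℚ) → evenSum d r n a q ≡ 0ℚ
  evenSum-vanishes degree<N den≢0 =
    trans (sumR-cong n (λ k _ → cong₂ (λ x y → x * inv y) (evenNum≡ k) (evenDen≡ k)))
          (terminating-sum-vanishes p u N n m (suc J) J X Y
             (a^s·qʳ·pᴺ≡1 _ (1-x≡-x+1 (+ d))) (ℕP.m<m+n N (s≤s z≤n)) (ℕP.m≤n+m (suc m) N)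
             (subst (λ e → e ℕ.* m < N) d∸1≡1+J+J degree<N)
             (λ k k<n den≡0 → den≢0 k k<n (trans (evenDen≡ k) den≡0)))
    where
    d∸1≡1+J+J : d ℕ.∸ 1 ≡ suc J ℕ.+ J
    d∸1≡1+J+J = trans (ℕP.+-suc J (J ℕ.+ 0)) (cong (λ t → suc (J ℕ.+ t)) (ℕP.+-identityʳ J))

OddSumVanishes : ℕ → ℤ → ℕ → ℚ → ℚ → Set
OddSumVanishes d r n a q = (∀ k → k < n → oddDen d r a q k ≢ 0ℚ) → oddSum d r n a q ≡ 0ℚ

EvenSumVanishes : ℕ → ℤ → ℕ → ℚ → ℚ → Set
EvenSumVanishes d r n a q = (∀ k → k < n → evenDen d r a q k ≢ 0ℚ) → evenSum d r n a q ≡ 0ℚ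

module Inversion {q : ℚ} (q≢0 : q ≢ 0ℚ) (n : ℕ) where

  a a⁻¹ : ℚ
  a = powZ q (+ n)
  a⁻¹ = powZ q (ℤ.- + n)

  powZ-a⁻¹ : ∀ z → powZ a⁻¹ z ≡ powZ a (ℤ.- z)
  powZ-a⁻¹ z = begin
    powZ a⁻¹ z               ≡⟨ powZ-*-assoc q≢0 (ℤ.- + n) z ⟩
    powZ q (ℤ.- + n ℤ.* z)   ≡⟨ cong (powZ q) (neg-swap (+ n) z) ⟩
    powZ q (+ n ℤ.* ℤ.- z)   ≡⟨ sym (powZ-*-assoc q≢0 (+ n) (ℤ.- z)) ⟩
    powZ a (ℤ.- z)           ∎
    where
    neg-swap : ∀ x z → ℤ.- x ℤ.* z ≡ x ℤ.* ℤ.- z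
    neg-swap = ℤ-Solver.solve-∀

  pair-inverse : ∀ z₁ z₂ x p k → ℤ.- z₁ ≡ z₂ →
    qpoch (powZ a⁻¹ z₁ * x) p k * qpoch (powZ a⁻¹ z₂ * x) p k ≡ qpoch (powZ a z₁ * x) p k * qpoch (powZ a z₂ * x) p k
  pair-inverse z₁ _ x p k refl = begin
    qpoch (powZ a⁻¹ z₁ * x) p k * qpoch (powZ a⁻¹ (ℤ.- z₁) * x) p k
      ≡⟨ cong₂ (λ s t → qpoch (s * x) p k * qpoch (t * x) p k)
               (powZ-a⁻¹ z₁) (trans (powZ-a⁻¹ (ℤ.- z₁)) (cong (powZ a) (ℤP.neg-involutive z₁))) ⟩
    qpoch (powZ a (ℤ.- z₁) * x) p k * qpoch (powZ a z₁ * x) p k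
      ≡⟨ *-comm (qpoch (powZ a (ℤ.- z₁) * x) p k) _ ⟩
    qpoch (powZ a z₁ * x) p k * qpoch (powZ a (ℤ.- z₁) * x) p k ∎

  -[x-1]≡1-x : ∀ x → ℤ.- (x ℤ.- + 1) ≡ + 1 ℤ.- x
  -[x-1]≡1-x = ℤ-Solver.solve-∀

  oddSumVanishes-inverse : ∀ d r → OddSumVanishes d r n a q → OddSumVanishes d r n a⁻¹ q
  oddSumVanishes-inverse d r vanishes den≢0 =
    trans (sumR-cong n (λ k _ → cong₂ (λ x y → x * inv y) (num k) (den k)))
          (vanishes (λ k k<n e → den≢0 k k<n (trans (den k) e)))
    where
    num : ∀ k → oddNum d r a⁻¹ q k ≡ oddNum d r a q k
    num k = cong (qpoch (powZ q r) (powN q d) k * powN q (d ℕ.* k) *_) (prodR-cong (d ℕ./ 2) (λ i _ →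
      pair-inverse (2j (suc i)) (ℤ.- 2j (suc i)) (powZ q r) (powN q d) k refl))
    den : ∀ k → oddDen d r a⁻¹ q k ≡ oddDen d r a q k
    den k = cong (qpoch (powN q d) (powN q d) k *_) (prodR-cong (d ℕ./ 2) (λ i _ →
      pair-inverse (2j-1 (suc i)) (1-2j (suc i)) (powN q d) (powN q d) k (-[x-1]≡1-x (2j (suc i)))))

  evenSumVanishes-inverse : ∀ d r → EvenSumVanishes d r n a q → EvenSumVanishes d r n a⁻¹ q
  evenSumVanishes-inverse d r vanishes den≢0 =
    trans (sumR-cong n (λ k _ → cong₂ (λ x y → x * inv y) (num k) (den k)))
          (vanishes (λ k k<n e → den≢0 k k<n (trans (den k) e)))
    where
    num : ∀ k → evenNum d r a⁻¹ q k ≡ evenNum d r a q k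
    num k = cong (powN q (d ℕ.* k) *_) (prodR-cong (d ℕ./ 2) (λ i _ →
      pair-inverse (2j-1 (suc i)) (1-2j (suc i)) (powZ q r) (powN q d) k (-[x-1]≡1-x (2j (suc i)))))
    den : ∀ k → evenDen d r a⁻¹ q k ≡ evenDen d r a q k
    den k = prodR-cong (d ℕ./ 2) (λ i _ → pair-inverse (2j i) (ℤ.- 2j i) (powN q d) (powN q d) k refl)

-- The arithmetic of the hypotheses

n+r≡[1+m]*d : ∀ d r n → 2 ≤ d → + d ℤD.∣ + n ℤ.+ r → + n ℤ.≥ + d ℤ.- r →
  ∃ λ m → + n ℤ.+ r ≡ + (suc m ℕ.* d)
n+r≡[1+m]*d d r n 2≤d (ℤD.divides t ∣n+r∣≡t*d) n≥d-r =
  positive t (trans (sym (ℤP.0≤i⇒+∣i∣≡i (ℤP.≤-trans (ℤ.+≤+ z≤n) d≤n+r))) (cong +_ ∣n+r∣≡t*d))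
  where
  cancel : ∀ d r → (d ℤ.- r) ℤ.+ r ≡ d
  cancel = ℤ-Solver.solve-∀
  d≤n+r : + d ℤ.≤ + n ℤ.+ r
  d≤n+r = ℤP.≤-trans (ℤP.≤-reflexive (sym (cancel (+ d) r))) (ℤP.+-monoˡ-≤ r n≥d-r)
  positive : ∀ t → + n ℤ.+ r ≡ + (t ℕ.* d) → ∃ λ m → + n ℤ.+ r ≡ + (suc m ℕ.* d)
  positive zero    n+r≡0 =
    ⊥-elim (ℕP.<⇒≱ (ℕP.≤-trans (s≤s z≤n) 2≤d) (ℤP.drop‿+≤+ (ℤP.≤-trans d≤n+r (ℤP.≤-reflexive n+r≡0))))
  positive (suc m) n+r≡[1+m]d = m , n+r≡[1+m]d

md+2≤n : ∀ d r n m → + n ℤ.+ r ≡ + (suc m ℕ.* d) → r ℤ.≤ + d ℤ.- + 2 → m ℕ.* d ℕ.+ 2 ≤ n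
md+2≤n d r n m n+r≡[1+m]d r≤d-2 =
  ℕP.+-cancelˡ-≤ d _ _ (subst₂ _≤_ (ℕP.+-assoc d (m ℕ.* d) 2) (ℕP.+-comm n d) (ℤP.drop‿+≤+ [1+m]d+2≤n+d))
  where
  cancel : ∀ n d → (n ℤ.+ (d ℤ.- + 2)) ℤ.+ + 2 ≡ n ℤ.+ d
  cancel = ℤ-Solver.solve-∀
  [1+m]d+2≤n+d : + (suc m ℕ.* d) ℤ.+ + 2 ℤ.≤ + n ℤ.+ + d
  [1+m]d+2≤n+d = ℤP.≤-trans (ℤP.≤-reflexive (cong (ℤ._+ + 2) (sym n+r≡[1+m]d)))
                   (ℤP.≤-trans (ℤP.+-monoˡ-≤ (+ 2) (ℤP.+-monoʳ-≤ (+ n) r≤d-2)) (ℤP.≤-reflexive (cancel (+ n) (+ d))))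

n≡N+1+m∧r≡[1+m]d-n : ∀ d r n → 2 ≤ d → r ℤ.≤ + d ℤ.- + 2 → + d ℤD.∣ + n ℤ.+ r → + n ℤ.≥ + d ℤ.- r →
  ∃₂ λ m N → n ≡ N ℕ.+ suc m × r ≡ + (suc m ℕ.* d) ℤ.- + n × (d ℕ.∸ 1) ℕ.* m < N
n≡N+1+m∧r≡[1+m]d-n (suc e) r n 2≤d r≤d-2 d∣n+r n≥d-r with n+r≡[1+m]*d (suc e) r n 2≤d d∣n+r n≥d-r
... | m , n+r≡[1+m]d with ℕP.m≤n⇒∃[o]m+o≡n (md+2≤n (suc e) r n m n+r≡[1+m]d r≤d-2)
...   | o , md+2+o≡n = m , suc (e ℕ.* m) ℕ.+ o , n≡N+1+m , r≡[1+m]d-n , s≤s (ℕP.m≤m+n (e ℕ.* m) o)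
  where
  isolate : ∀ n r → r ≡ (n ℤ.+ r) ℤ.- n
  isolate = ℤ-Solver.solve-∀
  r≡[1+m]d-n : r ≡ + (suc m ℕ.* suc e) ℤ.- + n
  r≡[1+m]d-n = trans (isolate (+ n) r) (cong (ℤ._- + n) n+r≡[1+m]d)
  regroup : ∀ e m o → m ℕ.* suc e ℕ.+ 2 ℕ.+ o ≡ suc (e ℕ.* m) ℕ.+ o ℕ.+ suc m
  regroup = ℕ-Solver.solve-∀
  n≡N+1+m : n ≡ suc (e ℕ.* m) ℕ.+ o ℕ.+ suc m
  n≡N+1+m = trans (sym md+2+o≡n) (regroup e m o)

∤2⇒odd : ∀ {d} → ¬ 2 ∣ d → ∃ λ J → d ≡ suc (2 ℕ.* J)
∤2⇒odd {d} 2∤d with d ℕ.% 2 in d%2≡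
... | 0           = ⊥-elim (2∤d (m%n≡0⇒n∣m d 2 d%2≡))
... | 1           = d ℕ./ 2 , trans (m≡m%n+[m/n]*n d 2) (cong₂ ℕ._+_ d%2≡ (ℕP.*-comm (d ℕ./ 2) 2))
... | suc (suc _) = ⊥-elim (ℕP.<⇒≱ (m%n<n d 2) (ℕP.≤-trans (s≤s (s≤s z≤n)) (ℕP.≤-reflexive (sym d%2≡))))

∣2⇒even : ∀ {d} → 2 ≤ d → 2 ∣ d → ∃ λ J → d ≡ 2 ℕ.* suc J
∣2⇒even 2≤d (divides zero    refl) = ⊥-elim (ℕP.<⇒≱ 2≤d z≤n)
∣2⇒even 2≤d (divides (suc J) refl) = J , ℕP.*-comm (suc J) 2

odd-sums-vanish : ∀ {q} → q ≢ 0ℚ → ∀ d m N → (d ℕ.∸ 1) ℕ.* m < N → ¬ 2 ∣ d →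
  OddSumVanishes d (+ (suc m ℕ.* d) ℤ.- + (N ℕ.+ suc m)) (N ℕ.+ suc m) (powZ q (+ (N ℕ.+ suc m))) q ×
  OddSumVanishes d (+ (suc m ℕ.* d) ℤ.- + (N ℕ.+ suc m)) (N ℕ.+ suc m) (powZ q (ℤ.- + (N ℕ.+ suc m))) q
odd-sums-vanish {q} q≢0 _ m N degree<N 2∤d with ∤2⇒odd 2∤d
... | J , refl = vanishes , oddSumVanishes-inverse d r vanishes
  where
  open Odd q≢0 J m N
  open Inversion q≢0 n using (oddSumVanishes-inverse)
  vanishes : OddSumVanishes d r n a q
  vanishes = oddSum-vanishes degree<N

even-sums-vanish : ∀ {q} → q ≢ 0ℚ → ∀ d m N → 2 ≤ d → (d ℕ.∸ 1) ℕ.* m < N → 2 ∣ d →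
  EvenSumVanishes d (+ (suc m ℕ.* d) ℤ.- + (N ℕ.+ suc m)) (N ℕ.+ suc m) (powZ q (+ (N ℕ.+ suc m))) q ×
  EvenSumVanishes d (+ (suc m ℕ.* d) ℤ.- + (N ℕ.+ suc m)) (N ℕ.+ suc m) (powZ q (ℤ.- + (N ℕ.+ suc m))) q
even-sums-vanish {q} q≢0 _ m N 2≤d degree<N 2∣d with ∣2⇒even 2≤d 2∣d
... | J , refl = vanishes , evenSumVanishes-inverse d r vanishes
  where
  open Even q≢0 J m N
  open Inversion q≢0 n using (evenSumVanishes-inverse)
  vanishes : EvenSumVanishes d r n a q
  vanishes = evenSum-vanishes degree<N

theorem2p1 : (d : ℕ) (r : ℤ) (n : ℕ) → d ≥ 2 → r ℤ.≤ + d ℤ.- + 2 → gcd r (+ d) ≡ + 1 →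
    n ≥ 1 → (+ d) ℤD.∣ (+ n ℤ.+ r) → + n ℤ.≥ + d ℤ.- r →
    (q : ℚ) → q ≢ 0ℚ →
    ((¬ (2 ∣ d) →
        ((∀ k → k < n → oddDen d r (powZ q (+ n)) q k ≢ 0ℚ) →
          oddSum d r n (powZ q (+ n)) q ≡ 0ℚ)
      × ((∀ k → k < n → oddDen d r (powZ q (ℤ.- + n)) q k ≢ 0ℚ) →
          oddSum d r n (powZ q (ℤ.- + n)) q ≡ 0ℚ))
    × (2 ∣ d →
        ((∀ k → k < n → evenDen d r (powZ q (+ n)) q k ≢ 0ℚ) →
          evenSum d r n (powZ q (+ n)) q ≡ 0ℚ)
      × ((∀ k → k < n → evenDen d r (powZ q (ℤ.- + n)) q k ≢ 0ℚ) →
          evenSum d r n (powZ q (ℤ.- + n)) q ≡ 0ℚ)))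
theorem2p1 d r n 2≤d r≤d-2 _ _ d∣n+r n≥d-r q q≢0 with n≡N+1+m∧r≡[1+m]d-n d r n 2≤d r≤d-2 d∣n+r n≥d-r
... | m , N , refl , refl , degree<N = odd-sums-vanish q≢0 d m N degree<N , even-sums-vanish q≢0 d m N 2≤d degree<N
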